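{- Let $P=(X,\leq)$ be a finite interval order and let $\lambda_1,\lambda_2$ be two admissible labellings of $P$. If $x,y\in X$ satisfy $\lambda_1(x)=\lambda_2(y)$, then $x\sim y$.
   Context: A finite poset $P=(X,\leq)$ is an interval order if there is a map assigning to each $x\in X$ a closed real interval $[a_x,b_x]$ such that $x<y$ in $P$ iff $b_x<a_y$ (equivalently, $P$ has no induced subposet isomorphic to $2+2$). For $x\in X$ let $I(x)=\{z: z<x\}$ and $F(x)=\{z : z>x\}$ (strict). Write $x\sim y$ (order equivalent) if $I(x)=I(y)$ and $F(x)=F(y)$. A linear extension of $P$ is a bijection $\lambda:X\to\{1,\dots,|X|\}$ with $x<y\Rightarrow\lambda(x)<\lambda(y)$. A linear extension $\lambda$ is an admissible labelling if for all $x,y\in X$ with $\lambda(x)<\lambda(y)$, either $I(x)\subset I(y)$, or ($I(x)=I(y)$ and $F(x)\subset F(y)$), or $x\sim y$. -}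

module Defs where

open import Data.Nat using (ℕ)
open import Data.Fin using (Fin) renaming (_<_ to _<ᶠ_)
open import Data.Product using (_×_; Σ; ∃)
open import Data.Sum using (_⊎_)
open import Relation.Nullary using (¬_)
open import Relation.Binary.Structures using (IsPartialOrder)
open import Relation.Binary.PropositionalEquality using (_≡_)
open import Function.Bundles using (Bijection; _⤖_)

record FinPoset (n : ℕ) : Set₁ where
  field
    _≤_ : Fin n → Fin n → Set
    isPartialOrder : IsPartialOrder _≡_ _≤_

  _<_ : Fin n → Fin n → Set
  x < y = (x ≤ y) × ¬ (x ≡ y)

  _∥_ : Fin n → Fin n → Set
  x ∥ y = ¬ (x ≤ y) × ¬ (y ≤ x)

  -- I(x) = {z : z < x}, F(x) = {z : z > x}, as predicates
  -- set equality / inclusion / strict inclusion of down-sets and up-sets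
  I⊆ : Fin n → Fin n → Set
  I⊆ x y = ∀ z → z < x → z < y

  I≡ : Fin n → Fin n → Set
  I≡ x y = I⊆ x y × I⊆ y x

  I⊂ : Fin n → Fin n → Set
  I⊂ x y = I⊆ x y × ¬ I⊆ y x

  F⊆ : Fin n → Fin n → Set
  F⊆ x y = ∀ z → x < z → y < z

  F≡ : Fin n → Fin n → Set
  F≡ x y = F⊆ x y × F⊆ y x

  F⊂ : Fin n → Fin n → Set
  F⊂ x y = F⊆ x y × ¬ F⊆ y x

  _∼_ : Fin n → Fin n → Set
  x ∼ y = I≡ x y × F≡ x y

open FinPoset public

-- Interval order: no induced subposet isomorphic to 2+2, i.e. there are no
-- a < b, c < d with a ∥ d and c ∥ b (an induced 2+2 then also forces
-- a ∥ c, b ∥ d automatically by transitivity).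
IsIntervalOrder : ∀ {n} → FinPoset n → Set
IsIntervalOrder {n} P =
  ¬ (Σ (Fin n) λ a → Σ (Fin n) λ b → Σ (Fin n) λ c → Σ (Fin n) λ d →
       (_<_ P a b) × (_<_ P c d) × (_∥_ P a d) × (_∥_ P c b))

-- A linear extension: a bijection λ : X → {1..n} (here Fin n, i.e. {0..n-1})
-- with x < y ⇒ λ x < λ y.
record LinearExtension {n : ℕ} (P : FinPoset n) : Set where
  field
    bij : Fin n ⤖ Fin n
  lab : Fin n → Fin n
  lab = Bijection.to bij
  field
    monotone : ∀ x y → _<_ P x y → lab x <ᶠ lab y

open LinearExtension public

IsAdmissible : ∀ {n} {P : FinPoset n} → LinearExtension P → Set
IsAdmissible {n} {P} L =
  ∀ x y → lab L x <ᶠ lab L y →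
    I⊂ P x y ⊎ (I≡ P x y × F⊂ P x y) ⊎ _∼_ P x y

-- Call u ≺ v when I(u) ⊂ I(v), or I(u) = I(v) and F(u) ⊂ F(v): a strict order
-- compatible with ∼, and admissibility says exactly that an admissible
-- labelling λ orders every pair as u ≺ v or u ∼ v whenever λ u < λ v.
-- Hence λ is strictly monotone for ≺.  Now if u ≺ v, then all λ₁ u + 1
-- elements w with λ₁ w ≤ λ₁ u satisfy w ≺ v, so they receive distinct
-- λ₂-labels below λ₂ v, and λ₁ u < λ₂ v.  Two elements with λ₁ x = λ₂ y are
-- therefore ≺-incomparable, and λ₁ compares them up to ∼.
module Submission where

open import Defs
open import Data.Nat using (ℕ)
open import Data.Fin using (Fin)
open import Relation.Binary.PropositionalEquality using (_≡_)

import Data.Nat as ℕ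
import Data.Nat.Properties as ℕₚ
open import Data.Fin using (toℕ; fromℕ<; inject≤) renaming (_≤_ to _≤ᶠ_; _<_ to _<ᶠ_)
open import Data.Fin.Properties
  using (toℕ-injective; toℕ-fromℕ<; toℕ<n; toℕ-inject≤; inject≤-injective; injective⇒≤; ≤-total; _<?_)
open import Data.Product using (_×_; _,_; proj₁; proj₂)
open import Data.Sum using (_⊎_; inj₁; inj₂; assocˡ)
open import Data.Empty using (⊥; ⊥-elim)
open import Function.Base using (_∘′_)
open import Function.Bundles using (Bijection)
open import Function.Definitions using (Injective; StrictlySurjective)
open import Relation.Binary.PropositionalEquality using (sym; cong; module ≡-Reasoning)
open import Relation.Nullary using (yes; no)

-- The w's ranked ≤ a by f form a copy of Fin (1 + toℕ a) injected by g into Fin (toℕ b).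
rank-<-by-pigeonhole : ∀ {A : Set} {n m} (f : A → Fin n) (g : A → Fin m) →
  StrictlySurjective _≡_ f → Injective _≡_ _≡_ g → ∀ {a : Fin n} {b : Fin m} →
  (∀ w → f w ≤ᶠ a → g w <ᶠ b) → toℕ a ℕ.< toℕ b
rank-<-by-pigeonhole {A} f g f-surj g-inj {a} {b} below = injective⇒≤ h-injective
  where
  section : Fin (ℕ.suc (toℕ a)) → A
  section i = proj₁ (f-surj (inject≤ i (toℕ<n a)))

  section-≤ : ∀ i → f (section i) ≤ᶠ a
  section-≤ i rewrite proj₂ (f-surj (inject≤ i (toℕ<n a))) | toℕ-inject≤ i (toℕ<n a) =
    ℕ.s≤s⁻¹ (toℕ<n i)

  h : Fin (ℕ.suc (toℕ a)) → Fin (toℕ b)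
  h i = fromℕ< (below (section i) (section-≤ i))

  open ≡-Reasoning

  h-injective : Injective _≡_ _≡_ h
  h-injective {i} {j} hi≡hj = inject≤-injective _ _ i j (begin
    inject≤ i _        ≡⟨ sym (proj₂ (f-surj _)) ⟩
    f (section i)      ≡⟨ cong f (g-inj (toℕ-injective gi≡gj)) ⟩
    f (section j)      ≡⟨ proj₂ (f-surj _) ⟩
    inject≤ j _        ∎)
    where
    gi≡gj : toℕ (g (section i)) ≡ toℕ (g (section j))
    gi≡gj = begin
      toℕ (g (section i)) ≡⟨ sym (toℕ-fromℕ< _) ⟩
      toℕ (h i)           ≡⟨ cong toℕ hi≡hj ⟩
      toℕ (h j)           ≡⟨ toℕ-fromℕ< _ ⟩
      toℕ (g (section j)) ∎

module _ {n : ℕ} (P : FinPoset n) where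

  infix 4 _≺_ _≼_

  _≺_ : Fin n → Fin n → Set
  u ≺ v = I⊂ P u v ⊎ (I≡ P u v × F⊂ P u v)

  _≼_ : Fin n → Fin n → Set
  u ≼ v = u ≺ v ⊎ _∼_ P u v

  ∼-refl : ∀ {x} → _∼_ P x x
  ∼-refl = ((λ _ p → p) , (λ _ p → p)) , ((λ _ p → p) , (λ _ p → p))

  ∼-sym : ∀ {x y} → _∼_ P x y → _∼_ P y x
  ∼-sym ((xy , yx) , (fxy , fyx)) = (yx , xy) , (fyx , fxy)

  ≺-irrefl : ∀ {u} → u ≺ u → ⊥
  ≺-irrefl (inj₁ (_ , I⊄)) = I⊄ λ _ p → p
  ≺-irrefl (inj₂ (_ , (_ , F⊄))) = F⊄ λ _ p → p

  I⊆-trans : ∀ {u v w} → I⊆ P u v → I⊆ P v w → I⊆ P u w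
  I⊆-trans uv vw z = vw z ∘′ uv z

  F⊆-trans : ∀ {u v w} → F⊆ P u v → F⊆ P v w → F⊆ P u w
  F⊆-trans uv vw z = vw z ∘′ uv z

  ≺-trans : ∀ {u v w} → u ≺ v → v ≺ w → u ≺ w
  ≺-trans (inj₁ (uv , _)) (inj₁ (vw , ¬wv)) =
    inj₁ (I⊆-trans uv vw , λ wu → ¬wv (I⊆-trans wu uv))
  ≺-trans (inj₁ (uv , ¬vu)) (inj₂ ((vw , _) , _)) =
    inj₁ (I⊆-trans uv vw , λ wu → ¬vu (I⊆-trans vw wu))
  ≺-trans (inj₂ ((uv , _) , _)) (inj₁ (vw , ¬wv)) =
    inj₁ (I⊆-trans uv vw , λ wu → ¬wv (I⊆-trans wu uv))
  ≺-trans (inj₂ ((uv , vu) , (fuv , _))) (inj₂ ((vw , wv) , (fvw , ¬fwv))) =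
    inj₂ ((I⊆-trans uv vw , I⊆-trans wv vu) ,
          (F⊆-trans fuv fvw , λ fwu → ¬fwv (F⊆-trans fwu fuv)))

  ∼-≺-trans : ∀ {u v w} → _∼_ P u v → v ≺ w → u ≺ w
  ∼-≺-trans ((uv , _) , _) (inj₁ (vw , ¬wv)) =
    inj₁ (I⊆-trans uv vw , λ wu → ¬wv (I⊆-trans wu uv))
  ∼-≺-trans ((uv , vu) , (fuv , _)) (inj₂ ((vw , wv) , (fvw , ¬fwv))) =
    inj₂ ((I⊆-trans uv vw , I⊆-trans wv vu) ,
          (F⊆-trans fuv fvw , λ fwu → ¬fwv (F⊆-trans fwu fuv)))

  ≼-≺-trans : ∀ {u v w} → u ≼ v → v ≺ w → u ≺ w
  ≼-≺-trans (inj₁ u≺v) = ≺-trans u≺v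
  ≼-≺-trans (inj₂ u∼v) = ∼-≺-trans u∼v

  module _ (L : LinearExtension P) (admissible : IsAdmissible L) where

    admissible-≤⇒≼ : ∀ {u v} → lab L u ≤ᶠ lab L v → u ≼ v
    admissible-≤⇒≼ {u} {v} λu≤λv with ℕₚ.m≤n⇒m<n∨m≡n λu≤λv
    ... | inj₂ λu≡λv rewrite Bijection.injective (bij L) (toℕ-injective λu≡λv) = inj₂ ∼-refl
    ... | inj₁ λu<λv = assocˡ (admissible u v λu<λv)

    admissible-≼-total : ∀ u v → u ≼ v ⊎ v ≼ u
    admissible-≼-total u v with ≤-total (lab L u) (lab L v)
    ... | inj₁ λu≤λv = inj₁ (admissible-≤⇒≼ λu≤λv)
    ... | inj₂ λv≤λu = inj₂ (admissible-≤⇒≼ λv≤λu)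

    admissible-≺⇒< : ∀ {u v} → u ≺ v → lab L u <ᶠ lab L v
    admissible-≺⇒< {u} {v} u≺v with lab L u <? lab L v
    ... | yes λu<λv = λu<λv
    ... | no λu≮λv = ⊥-elim (≺-irrefl (≼-≺-trans (admissible-≤⇒≼ (ℕₚ.≮⇒≥ λu≮λv)) u≺v))

  admissible-≺⇒<-across : ∀ (L₁ L₂ : LinearExtension P) →
    IsAdmissible L₁ → IsAdmissible L₂ → ∀ {u v} → u ≺ v → lab L₁ u <ᶠ lab L₂ v
  admissible-≺⇒<-across L₁ L₂ ad₁ ad₂ u≺v =
    rank-<-by-pigeonhole (lab L₁) (lab L₂)
      (Bijection.strictlySurjective (bij L₁)) (Bijection.injective (bij L₂))
      λ w λ₁w≤λ₁u → admissible-≺⇒< L₂ ad₂ (≼-≺-trans (admissible-≤⇒≼ L₁ ad₁ λ₁w≤λ₁u) u≺v)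

mainTheorem4 : (n : ℕ) (P : FinPoset n) → IsIntervalOrder P →
    (L₁ L₂ : LinearExtension P) → IsAdmissible L₁ → IsAdmissible L₂ →
    (x y : Fin n) → lab L₁ x ≡ lab L₂ y → _∼_ P x y
mainTheorem4 n P _ L₁ L₂ ad₁ ad₂ x y λ₁x≡λ₂y with admissible-≼-total P L₁ ad₁ x y
... | inj₁ (inj₂ x∼y) = x∼y
... | inj₂ (inj₂ y∼x) = ∼-sym P y∼x
... | inj₁ (inj₁ x≺y) =
  ⊥-elim (ℕₚ.<-irrefl (cong toℕ λ₁x≡λ₂y) (admissible-≺⇒<-across P L₁ L₂ ad₁ ad₂ x≺y))
... | inj₂ (inj₁ y≺x) =
  ⊥-elim (ℕₚ.<-irrefl (cong toℕ (sym λ₁x≡λ₂y)) (admissible-≺⇒<-across P L₂ L₁ ad₂ ad₁ y≺x))
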